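{- The parameter set $3$-$(11,5,2)$ is admissible, but there is no $3$-$(11,5,2)$ block design.
   Context: A $t$-$(v,k,\lambda)$ (block) design is a set $D$ of $k$-element subsets (blocks) of a $v$-element set $V$ such that every $t$-element subset of $V$ is contained in exactly $\lambda$ blocks (blocks are not repeated). The parameter set $t$-$(v,k,\lambda)$ is admissible if $\lambda_i=\frac{\binom{v-i}{t-i}}{\binom{k-i}{t-i}}\lambda$ is an integer for all $i\in\{0,\ldots,t\}$. A parameter set is realizable if a design with these parameters exists. -}

module Defs where

open import Data.Nat using (ℕ; _∸_; _*_; _≤_)
open import Data.Nat.Divisibility using (_∣_)
open import Data.Nat.Combinatorics using (_C_)
open import Data.Fin.Subset using (Subset; ∣_∣; _⊆_)
open import Data.Fin.Subset.Properties using (_⊆?_)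
open import Data.List using (List; length; filter)
open import Data.List.Relation.Unary.All using (All)
open import Data.List.Relation.Unary.Unique.Propositional using (Unique)
open import Relation.Binary.PropositionalEquality using (_≡_)

count⊇ : ∀ {v} → Subset v → List (Subset v) → ℕ
count⊇ T D = length (filter (T ⊆?_) D)

record IsDesign (t v k lam : ℕ) (D : List (Subset v)) : Set where
  field
    noRepeat  : Unique D
    blockSize : All (λ B → ∣ B ∣ ≡ k) D
    balanced  : ∀ (T : Subset v) → ∣ T ∣ ≡ t → count⊇ T D ≡ lam

-- admissible: λ_i = C(v-i,t-i)/C(k-i,t-i) * λ is an integer for all i ≤ t,
-- i.e. C(k-i,t-i) divides C(v-i,t-i) * λ.
Admissible : (t v k lam : ℕ) → Set
Admissible t v k lam = ∀ i → i ≤ t → ((k ∸ i) C (t ∸ i)) ∣ (((v ∸ i) C (t ∸ i)) * lam)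

-- Fix a 3-(11,5,2) design D and a 5-set X, and let i = |X ∩ B|, c = |B ∖ X| for a block B.
-- Double counting the triples inside blocks with a prescribed number of points in X gives
-- Σ_B C(i,j) C(c,3-j) = 2 C(5,j) C(6,3-j), and a suitable combination of these counts shows
-- Σ_B w(i) = 15 for a nonnegative weight w with w(1) = 1, w(4) = 4, w(5) = 15, w(0) = w(2) = w(3) = 0.
-- For X = B₀ a block, B₀ itself already contributes 15, so every other block meets B₀ in
-- 0, 2 or 3 points, and the counts then force exactly two blocks x, y disjoint from B₀.
-- Both lie in the 6-point complement of B₀, so |x ∩ y| ≥ 4 and X = x gets Σ_B w ≥ 15 + 1.
module Submission where

open import Defs
open import Data.Bool using (true; false; if_then_else_)
open import Data.Empty using (⊥)
open import Data.Fin.Subset using (Subset; inside; outside; ⊤; ∁; _∩_; ∣_∣) renaming (⊥ to ∅)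
open import Data.Fin.Subset.Properties using (_⊆?_; ⊆⊤; ∩-idem; ∩-identityʳ; ∣∁p∣≡n∸∣p∣; ∣p∩q∣≤∣q∣)
open import Data.List using (List; []; _∷_; _++_; map; length; filter)
open import Data.List.Relation.Unary.All as All using (All; []; _∷_)
open import Data.List.Relation.Unary.All.Properties using (all-filter; filter⁺; map⁺; ++⁺)
open import Data.Nat using (ℕ; zero; suc; _+_; _*_; _∸_; _≤_; _≟_; z≤n; s≤s)
open import Data.Nat.Combinatorics using (_C_; nCk+nC[k+1]≡[n+1]C[k+1])
open import Data.Nat.Divisibility using (divides)
open import Data.Nat.Properties
open import Algebra.Properties.CommutativeSemigroup +-commutativeSemigroup using (interchange)
open import Data.Product using (_×_; ∃; ∃₂; _,_)
open import Data.Vec using ([]; _∷_)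
open import Relation.Nullary using (¬_; Dec; does; _because_)
open import Relation.Nullary.Decidable using (dec-true)
open import Relation.Unary using (Decidable)
open import Relation.Binary.PropositionalEquality

∑ : {A : Set} → (A → ℕ) → List A → ℕ
∑ f []       = 0
∑ f (x ∷ xs) = f x + ∑ f xs

syntax ∑ (λ x → e) xs = ∑[ x ∈ xs ] e

module _ {A : Set} where

  ∑-cong : {f g : A → ℕ} {xs : List A} → All (λ x → f x ≡ g x) xs → ∑ f xs ≡ ∑ g xs
  ∑-cong []            = refl
  ∑-cong (fx≡gx ∷ eqs) = cong₂ _+_ fx≡gx (∑-cong eqs)

  ∑-cong′ : {f g : A → ℕ} → (∀ x → f x ≡ g x) → (xs : List A) → ∑ f xs ≡ ∑ g xs
  ∑-cong′ f≗g []       = refl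
  ∑-cong′ f≗g (x ∷ xs) = cong₂ _+_ (f≗g x) (∑-cong′ f≗g xs)

  ∑-+ : (f g : A → ℕ) (xs : List A) → ∑[ x ∈ xs ] (f x + g x) ≡ ∑ f xs + ∑ g xs
  ∑-+ f g []       = refl
  ∑-+ f g (x ∷ xs) = trans (cong (f x + g x +_) (∑-+ f g xs)) (interchange (f x) (g x) _ _)

  ∑-* : (c : ℕ) (f : A → ℕ) (xs : List A) → ∑[ x ∈ xs ] (c * f x) ≡ c * ∑ f xs
  ∑-* c f []       = sym (*-zeroʳ c)
  ∑-* c f (x ∷ xs) = trans (cong (c * f x +_) (∑-* c f xs)) (sym (*-distribˡ-+ c (f x) _))

  ∑-++ : (f : A → ℕ) (xs ys : List A) → ∑ f (xs ++ ys) ≡ ∑ f xs + ∑ f ys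
  ∑-++ f []       ys = refl
  ∑-++ f (x ∷ xs) ys = trans (cong (f x +_) (∑-++ f xs ys)) (sym (+-assoc (f x) _ _))

  ∑≡0⇒All≡0 : (f : A → ℕ) (xs : List A) → ∑ f xs ≡ 0 → All (λ x → f x ≡ 0) xs
  ∑≡0⇒All≡0 f []       _   = []
  ∑≡0⇒All≡0 f (x ∷ xs) eq = m+n≡0⇒m≡0 (f x) eq ∷ ∑≡0⇒All≡0 f xs (m+n≡0⇒n≡0 (f x) eq)

  ∑-filter-≤ : {P : A → Set} (P? : Decidable P) (f : A → ℕ) (xs : List A) →
               ∑ f (filter P? xs) ≤ ∑ f xs
  ∑-filter-≤ P? f []       = z≤n
  ∑-filter-≤ P? f (x ∷ xs) with does (P? x)
  ... | true  = +-monoʳ-≤ (f x) (∑-filter-≤ P? f xs)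
  ... | false = ≤-trans (∑-filter-≤ P? f xs) (m≤n+m _ (f x))

∑-comm : {A B : Set} (F : A → B → ℕ) (xs : List A) (ys : List B) →
         ∑[ x ∈ xs ] ∑[ y ∈ ys ] F x y ≡ ∑[ y ∈ ys ] ∑[ x ∈ xs ] F x y
∑-comm F []       ys = sym (zeros ys)
  where
  zeros : ∀ ys → ∑ (λ _ → 0) ys ≡ 0
  zeros []       = refl
  zeros (_ ∷ ys) = zeros ys
∑-comm F (x ∷ xs) ys = begin
  ∑ (F x) ys + ∑[ x′ ∈ xs ] ∑[ y ∈ ys ] F x′ y ≡⟨ cong (∑ (F x) ys +_) (∑-comm F xs ys) ⟩
  ∑ (F x) ys + ∑[ y ∈ ys ] ∑[ x′ ∈ xs ] F x′ y ≡⟨ ∑-+ (F x) _ ys ⟨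
  ∑[ y ∈ ys ] (F x y + ∑[ x′ ∈ xs ] F x′ y)    ∎
  where open ≡-Reasoning

𝟙 : {P : Set} → Dec P → ℕ
𝟙 P? = if does P? then 1 else 0

length-filter≡∑𝟙 : {A : Set} {P : A → Set} (P? : Decidable P) (xs : List A) →
                   length (filter P? xs) ≡ ∑[ x ∈ xs ] 𝟙 (P? x)
length-filter≡∑𝟙 P? []       = refl
length-filter≡∑𝟙 P? (x ∷ xs) with P? x
... | true  because _ = cong suc (length-filter≡∑𝟙 P? xs)
... | false because _ = length-filter≡∑𝟙 P? xs

∣p∩q∣+∣∁p∩q∣≡∣q∣ : ∀ {n} (p q : Subset n) → ∣ p ∩ q ∣ + ∣ ∁ p ∩ q ∣ ≡ ∣ q ∣
∣p∩q∣+∣∁p∩q∣≡∣q∣ []            []            = refl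
∣p∩q∣+∣∁p∩q∣≡∣q∣ (inside  ∷ p) (inside  ∷ q) = cong suc (∣p∩q∣+∣∁p∩q∣≡∣q∣ p q)
∣p∩q∣+∣∁p∩q∣≡∣q∣ (inside  ∷ p) (outside ∷ q) = ∣p∩q∣+∣∁p∩q∣≡∣q∣ p q
∣p∩q∣+∣∁p∩q∣≡∣q∣ (outside ∷ p) (inside  ∷ q) = trans (+-suc _ _) (cong suc (∣p∩q∣+∣∁p∩q∣≡∣q∣ p q))
∣p∩q∣+∣∁p∩q∣≡∣q∣ (outside ∷ p) (outside ∷ q) = ∣p∩q∣+∣∁p∩q∣≡∣q∣ p q

∣∁p∩p∣≡0 : ∀ {n} (p : Subset n) → ∣ ∁ p ∩ p ∣ ≡ 0
∣∁p∩p∣≡0 []            = refl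
∣∁p∩p∣≡0 (inside  ∷ p) = ∣∁p∩p∣≡0 p
∣∁p∩p∣≡0 (outside ∷ p) = ∣∁p∩p∣≡0 p

-- Inclusion–exclusion for two sets inside the complement of r.
∣p∣+∣q∣≤∣p∩q∣+∣∁r∣ : ∀ {n} (r p q : Subset n) → ∣ r ∩ p ∣ ≡ 0 → ∣ r ∩ q ∣ ≡ 0 →
                     ∣ p ∣ + ∣ q ∣ ≤ ∣ p ∩ q ∣ + ∣ ∁ r ∣
∣p∣+∣q∣≤∣p∩q∣+∣∁r∣ [] [] [] _ _ = z≤n
∣p∣+∣q∣≤∣p∩q∣+∣∁r∣ (inside ∷ r) (inside  ∷ p) _             () _
∣p∣+∣q∣≤∣p∩q∣+∣∁r∣ (inside ∷ r) (outside ∷ p) (inside  ∷ q) _  ()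
∣p∣+∣q∣≤∣p∩q∣+∣∁r∣ (inside ∷ r) (outside ∷ p) (outside ∷ q) rp rq = ∣p∣+∣q∣≤∣p∩q∣+∣∁r∣ r p q rp rq
∣p∣+∣q∣≤∣p∩q∣+∣∁r∣ (outside ∷ r) (inside ∷ p) (inside ∷ q) rp rq
  rewrite +-suc ∣ p ∣ ∣ q ∣ | +-suc ∣ p ∩ q ∣ ∣ ∁ r ∣ = s≤s (s≤s (∣p∣+∣q∣≤∣p∩q∣+∣∁r∣ r p q rp rq))
∣p∣+∣q∣≤∣p∩q∣+∣∁r∣ (outside ∷ r) (inside ∷ p) (outside ∷ q) rp rq
  rewrite +-suc ∣ p ∩ q ∣ ∣ ∁ r ∣ = s≤s (∣p∣+∣q∣≤∣p∩q∣+∣∁r∣ r p q rp rq)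
∣p∣+∣q∣≤∣p∩q∣+∣∁r∣ (outside ∷ r) (outside ∷ p) (inside ∷ q) rp rq
  rewrite +-suc ∣ p ∣ ∣ q ∣ | +-suc ∣ p ∩ q ∣ ∣ ∁ r ∣ = s≤s (∣p∣+∣q∣≤∣p∩q∣+∣∁r∣ r p q rp rq)
∣p∣+∣q∣≤∣p∩q∣+∣∁r∣ (outside ∷ r) (outside ∷ p) (outside ∷ q) rp rq =
  ≤-trans (∣p∣+∣q∣≤∣p∩q∣+∣∁r∣ r p q rp rq) (+-monoʳ-≤ ∣ p ∩ q ∣ (n≤1+n ∣ ∁ r ∣))

extend : ∀ {n} → List (Subset n) → List (Subset n) → List (Subset (suc n))
extend Ts Us = map (inside ∷_) Ts ++ map (outside ∷_) Us

mixedSubsets : ∀ {n} → Subset n → ℕ → ℕ → List (Subset n)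
mixedSubsets []            zero    zero    = [] ∷ []
mixedSubsets []            _       _       = []
mixedSubsets (inside  ∷ X) zero    k       = map (outside ∷_) (mixedSubsets X zero k)
mixedSubsets (inside  ∷ X) (suc j) k       = extend (mixedSubsets X j k) (mixedSubsets X (suc j) k)
mixedSubsets (outside ∷ X) j       zero    = map (outside ∷_) (mixedSubsets X j zero)
mixedSubsets (outside ∷ X) j       (suc k) = extend (mixedSubsets X j k) (mixedSubsets X j (suc k))

mixedSubsets-size : ∀ {n} (X : Subset n) j k → All (λ T → ∣ T ∣ ≡ j + k) (mixedSubsets X j k)
mixedSubsets-size []            zero    zero    = refl ∷ []
mixedSubsets-size []            zero    (suc k) = []
mixedSubsets-size []            (suc j) k       = []
mixedSubsets-size (inside  ∷ X) zero    k       = map⁺ (mixedSubsets-size X zero k)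
mixedSubsets-size (inside  ∷ X) (suc j) k       =
  ++⁺ (map⁺ (All.map (cong suc) (mixedSubsets-size X j k))) (map⁺ (mixedSubsets-size X (suc j) k))
mixedSubsets-size (outside ∷ X) j       zero    = map⁺ (mixedSubsets-size X j zero)
mixedSubsets-size (outside ∷ X) j       (suc k) =
  ++⁺ (map⁺ (All.map (λ eq → trans (cong suc eq) (sym (+-suc j k))) (mixedSubsets-size X j k)))
      (map⁺ (mixedSubsets-size X j (suc k)))

#⊆ : ∀ {n} → Subset n → List (Subset n) → ℕ
#⊆ Y Ts = ∑[ T ∈ Ts ] 𝟙 (T ⊆? Y)

module _ {n} {Y : Subset n} where

  #⊆-map-outside∷ : ∀ y Ts → #⊆ (y ∷ Y) (map (outside ∷_) Ts) ≡ #⊆ Y Ts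
  #⊆-map-outside∷ y []       = refl
  #⊆-map-outside∷ y (T ∷ Ts) = cong (𝟙 (T ⊆? Y) +_) (#⊆-map-outside∷ y Ts)

  #⊆-extend-inside : ∀ Ts Us → #⊆ (inside ∷ Y) (extend Ts Us) ≡ #⊆ Y Ts + #⊆ Y Us
  #⊆-extend-inside Ts Us = trans (∑-++ _ (map (inside ∷_) Ts) _)
                                 (cong₂ _+_ (inside∷ Ts) (#⊆-map-outside∷ inside Us))
    where
    inside∷ : ∀ Ts → #⊆ (inside ∷ Y) (map (inside ∷_) Ts) ≡ #⊆ Y Ts
    inside∷ []       = refl
    inside∷ (T ∷ Ts) = cong (𝟙 (T ⊆? Y) +_) (inside∷ Ts)

  #⊆-extend-outside : ∀ Ts Us → #⊆ (outside ∷ Y) (extend Ts Us) ≡ #⊆ Y Us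
  #⊆-extend-outside Ts Us = trans (∑-++ _ (map (inside ∷_) Ts) _)
                                  (cong₂ _+_ (outside∷ Ts) (#⊆-map-outside∷ outside Us))
    where
    outside∷ : ∀ Ts → #⊆ (outside ∷ Y) (map (inside ∷_) Ts) ≡ 0
    outside∷ []       = refl
    outside∷ (T ∷ Ts) = outside∷ Ts

#⊆-mixedSubsets : ∀ {n} (X Y : Subset n) j k →
                  #⊆ Y (mixedSubsets X j k) ≡ (∣ X ∩ Y ∣ C j) * (∣ ∁ X ∩ Y ∣ C k)
#⊆-mixedSubsets []            []            zero    zero    = refl
#⊆-mixedSubsets []            []            zero    (suc k) = refl
#⊆-mixedSubsets []            []            (suc j) k       = refl
#⊆-mixedSubsets (inside  ∷ X) (y ∷ Y)       zero    k       =
  trans (#⊆-map-outside∷ y (mixedSubsets X zero k)) (#⊆-mixedSubsets X Y zero k)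
#⊆-mixedSubsets (inside  ∷ X) (inside  ∷ Y) (suc j) k       = begin
  #⊆ (inside ∷ Y) (extend (mixedSubsets X j k) (mixedSubsets X (suc j) k))
    ≡⟨ #⊆-extend-inside (mixedSubsets X j k) _ ⟩
  #⊆ Y (mixedSubsets X j k) + #⊆ Y (mixedSubsets X (suc j) k)
    ≡⟨ cong₂ _+_ (#⊆-mixedSubsets X Y j k) (#⊆-mixedSubsets X Y (suc j) k) ⟩
  (a C j) * (b C k) + (a C suc j) * (b C k)
    ≡⟨ *-distribʳ-+ (b C k) (a C j) (a C suc j) ⟨
  (a C j + a C suc j) * (b C k)
    ≡⟨ cong (_* (b C k)) (nCk+nC[k+1]≡[n+1]C[k+1] a j) ⟩
  (suc a C suc j) * (b C k) ∎
  where open ≡-Reasoning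
        a = ∣ X ∩ Y ∣
        b = ∣ ∁ X ∩ Y ∣
#⊆-mixedSubsets (inside  ∷ X) (outside ∷ Y) (suc j) k       =
  trans (#⊆-extend-outside (mixedSubsets X j k) _) (#⊆-mixedSubsets X Y (suc j) k)
#⊆-mixedSubsets (outside ∷ X) (y ∷ Y)       j       zero    =
  trans (#⊆-map-outside∷ y (mixedSubsets X j zero)) (#⊆-mixedSubsets X Y j zero)
#⊆-mixedSubsets (outside ∷ X) (inside  ∷ Y) j       (suc k) = begin
  #⊆ (inside ∷ Y) (extend (mixedSubsets X j k) (mixedSubsets X j (suc k)))
    ≡⟨ #⊆-extend-inside (mixedSubsets X j k) _ ⟩
  #⊆ Y (mixedSubsets X j k) + #⊆ Y (mixedSubsets X j (suc k))
    ≡⟨ cong₂ _+_ (#⊆-mixedSubsets X Y j k) (#⊆-mixedSubsets X Y j (suc k)) ⟩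
  (a C j) * (b C k) + (a C j) * (b C suc k)
    ≡⟨ *-distribˡ-+ (a C j) (b C k) (b C suc k) ⟨
  (a C j) * (b C k + b C suc k)
    ≡⟨ cong ((a C j) *_) (nCk+nC[k+1]≡[n+1]C[k+1] b k) ⟩
  (a C j) * (suc b C suc k) ∎
  where open ≡-Reasoning
        a = ∣ X ∩ Y ∣
        b = ∣ ∁ X ∩ Y ∣
#⊆-mixedSubsets (outside ∷ X) (outside ∷ Y) j       (suc k) =
  trans (#⊆-extend-outside (mixedSubsets X j k) _) (#⊆-mixedSubsets X Y j (suc k))

mixedChoices : ∀ {v} → ℕ → ℕ → Subset v → Subset v → ℕ
mixedChoices i j X B = (∣ X ∩ B ∣ C i) * (∣ ∁ X ∩ B ∣ C j)

∑-mixedChoices : ∀ {t v k lam D} → IsDesign t v k lam D → (X : Subset v) → ∀ i j → i + j ≡ t →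
                 ∑[ B ∈ D ] mixedChoices i j X B ≡ lam * ((∣ X ∣ C i) * ((v ∸ ∣ X ∣) C j))
∑-mixedChoices {v = v} {lam = lam} {D = D} design X i j i+j≡t = begin
  ∑[ B ∈ D ] mixedChoices i j X B               ≡⟨ ∑-cong′ (λ B → #⊆-mixedSubsets X B i j) D ⟨
  ∑[ B ∈ D ] ∑[ T ∈ Ts ] 𝟙 (T ⊆? B)             ≡⟨ ∑-comm (λ B T → 𝟙 (T ⊆? B)) D Ts ⟩
  ∑[ T ∈ Ts ] ∑[ B ∈ D ] 𝟙 (T ⊆? B)             ≡⟨ ∑-cong (All.map (λ {T} → blocks⊇ T) (mixedSubsets-size X i j)) ⟩
  ∑[ T ∈ Ts ] (lam * 𝟙 (T ⊆? ⊤))                ≡⟨ ∑-* lam _ Ts ⟩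
  lam * #⊆ ⊤ Ts                                 ≡⟨ cong (lam *_) (#⊆-mixedSubsets X ⊤ i j) ⟩
  lam * ((∣ X ∩ ⊤ ∣ C i) * (∣ ∁ X ∩ ⊤ ∣ C j))   ≡⟨ cong₂ (λ a b → lam * ((a C i) * (b C j)))
                                                         (cong ∣_∣ (∩-identityʳ X))
                                                         (trans (cong ∣_∣ (∩-identityʳ (∁ X))) (∣∁p∣≡n∸∣p∣ X)) ⟩
  lam * ((∣ X ∣ C i) * ((v ∸ ∣ X ∣) C j))       ∎
  where
  open ≡-Reasoning
  Ts = mixedSubsets X i j
  blocks⊇ : ∀ T → ∣ T ∣ ≡ i + j → ∑[ B ∈ D ] 𝟙 (T ⊆? B) ≡ lam * 𝟙 (T ⊆? ⊤)
  blocks⊇ T ∣T∣≡i+j = begin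
    ∑[ B ∈ D ] 𝟙 (T ⊆? B)  ≡⟨ length-filter≡∑𝟙 (T ⊆?_) D ⟨
    count⊇ T D             ≡⟨ IsDesign.balanced design T (trans ∣T∣≡i+j i+j≡t) ⟩
    lam                    ≡⟨ *-identityʳ lam ⟨
    lam * 1                ≡⟨ cong (λ b → lam * (if b then 1 else 0)) (dec-true (T ⊆? ⊤) ⊆⊤) ⟨
    lam * 𝟙 (T ⊆? ⊤)       ∎

-- 6 · weight i = i C(c,2) + 9 C(i,3) − 2 C(i,2) c for c = 5 − i, a combination of the
-- triple counts that the design fixes (weight-identity).
weight : ℕ → ℕ
weight 1 = 1
weight 4 = 4
weight 5 = 15
weight _ = 0

weight-identity : ∀ i c → i + c ≡ 5 →
                  6 * weight i + 2 * ((i C 2) * (c C 1)) ≡ (i C 1) * (c C 2) + 9 * ((i C 3) * (c C 0))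
weight-identity 0 _ refl = refl
weight-identity 1 _ refl = refl
weight-identity 2 _ refl = refl
weight-identity 3 _ refl = refl
weight-identity 4 _ refl = refl
weight-identity 5 _ refl = refl

disjointness-identity : ∀ i c → i + c ≡ 5 → weight i ≡ 0 →
                        6 * ((i C 0) * (c C 3)) + 3 * ((i C 3) * (c C 0)) ≡ 60 * 𝟙 (i ≟ 0) + (i C 1) * (c C 2)
disjointness-identity 0 _ refl _ = refl
disjointness-identity 2 _ refl _ = refl
disjointness-identity 3 _ refl _ = refl
disjointness-identity 1 _ refl ()
disjointness-identity 4 _ refl ()
disjointness-identity 5 _ refl ()

weight-pos : ∀ i → 4 ≤ i → i ≤ 5 → 1 ≤ weight i
weight-pos 4 _ _ = s≤s z≤n
weight-pos 5 _ _ = s≤s z≤n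
weight-pos 1 (s≤s ()) _
weight-pos 2 (s≤s (s≤s ())) _
weight-pos 3 (s≤s (s≤s (s≤s ()))) _
weight-pos (suc (suc (suc (suc (suc (suc _)))))) _ (s≤s (s≤s (s≤s (s≤s (s≤s ())))))

length≡2 : {A : Set} (xs : List A) → length xs ≡ 2 → ∃₂ λ x y → xs ≡ x ∷ y ∷ []
length≡2 (x ∷ y ∷ []) refl = x , y , refl

4≤∣p∩q∣ : (r p q : Subset 11) → ∣ r ∣ ≡ 5 → ∣ p ∣ ≡ 5 → ∣ q ∣ ≡ 5 → ∣ r ∩ p ∣ ≡ 0 → ∣ r ∩ q ∣ ≡ 0 →
          4 ≤ ∣ p ∩ q ∣
4≤∣p∩q∣ r p q ∣r∣≡5 ∣p∣≡5 ∣q∣≡5 r∩p≡∅ r∩q≡∅ = +-cancelʳ-≤ 6 4 ∣ p ∩ q ∣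
  (subst₂ _≤_ (cong₂ _+_ ∣p∣≡5 ∣q∣≡5) (cong (∣ p ∩ q ∣ +_) (trans (∣∁p∣≡n∸∣p∣ r) (cong (11 ∸_) ∣r∣≡5)))
          (∣p∣+∣q∣≤∣p∩q∣+∣∁r∣ r p q r∩p≡∅ r∩q≡∅))

module _ {D : List (Subset 11)} (design : IsDesign 3 11 5 2 D) where
  open IsDesign design

  meet+miss≡5 : (X : Subset 11) → All (λ B → ∣ X ∩ B ∣ + ∣ ∁ X ∩ B ∣ ≡ 5) D
  meet+miss≡5 X = All.map (trans (∣p∩q∣+∣∁p∩q∣≡∣q∣ X _)) blockSize

  ∑-mixedChoices-5set : ∀ X → ∣ X ∣ ≡ 5 → ∀ i j → i + j ≡ 3 →
                        ∑[ B ∈ D ] mixedChoices i j X B ≡ 2 * ((5 C i) * (6 C j))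
  ∑-mixedChoices-5set X ∣X∣≡5 i j i+j≡3 =
    trans (∑-mixedChoices design X i j i+j≡3) (cong (λ m → 2 * ((m C i) * ((11 ∸ m) C j))) ∣X∣≡5)

  ∑-weight≡15 : ∀ X → ∣ X ∣ ≡ 5 → ∑[ B ∈ D ] weight ∣ X ∩ B ∣ ≡ 15
  ∑-weight≡15 X ∣X∣≡5 = *-cancelˡ-≡ _ 15 6 (+-cancelʳ-≡ 240 _ _ (begin
    6 * ∑ w D + 240
      ≡⟨ cong₂ _+_ (∑-* 6 w D) (trans (∑-* 2 (m 2 1) D) (cong (2 *_) (count 2 1 refl))) ⟨
    ∑[ B ∈ D ] (6 * w B) + ∑[ B ∈ D ] (2 * m 2 1 B)
      ≡⟨ ∑-+ _ _ D ⟨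
    ∑[ B ∈ D ] (6 * w B + 2 * m 2 1 B)
      ≡⟨ ∑-cong (All.map (λ {B} → weight-identity ∣ X ∩ B ∣ ∣ ∁ X ∩ B ∣) (meet+miss≡5 X)) ⟩
    ∑[ B ∈ D ] (m 1 2 B + 9 * m 3 0 B)
      ≡⟨ ∑-+ _ _ D ⟩
    ∑ (m 1 2) D + ∑[ B ∈ D ] (9 * m 3 0 B)
      ≡⟨ cong₂ _+_ (count 1 2 refl) (trans (∑-* 9 (m 3 0) D) (cong (9 *_) (count 3 0 refl))) ⟩
    6 * 15 + 240 ∎))
    where
    open ≡-Reasoning
    w : Subset 11 → ℕ
    w B = weight ∣ X ∩ B ∣
    m : ℕ → ℕ → Subset 11 → ℕ
    m i j = mixedChoices i j X
    count : ∀ i j → i + j ≡ 3 → ∑ (m i j) D ≡ 2 * ((5 C i) * (6 C j))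
    count = ∑-mixedChoices-5set X ∣X∣≡5

module _ {B₀ : Subset 11} {D : List (Subset 11)} (design : IsDesign 3 11 5 2 (B₀ ∷ D)) where
  open IsDesign design

  private
    ∣B₀∣≡5 : ∣ B₀ ∣ ≡ 5
    ∣B₀∣≡5 = All.head blockSize

    ∣B₀∩B₀∣≡5 : ∣ B₀ ∩ B₀ ∣ ≡ 5
    ∣B₀∩B₀∣≡5 = trans (cong ∣_∣ (∩-idem B₀)) ∣B₀∣≡5

  -- B₀ alone already accounts for the whole weight 15.
  others-weight≡0 : All (λ B → weight ∣ B₀ ∩ B ∣ ≡ 0) D
  others-weight≡0 = ∑≡0⇒All≡0 _ D (+-cancelˡ-≡ 15 _ 0 (trans
    (cong (λ i → weight i + ∑[ B ∈ D ] weight ∣ B₀ ∩ B ∣) (sym ∣B₀∩B₀∣≡5))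
    (∑-weight≡15 design B₀ ∣B₀∣≡5)))

  ∑-mixedChoices-others : ∀ i j → i + j ≡ 3 →
                          (5 C i) * (0 C j) + ∑[ B ∈ D ] mixedChoices i j B₀ B ≡ 2 * ((5 C i) * (6 C j))
  ∑-mixedChoices-others i j i+j≡3 =
    trans (cong₂ (λ a b → (a C i) * (b C j) + ∑ (mixedChoices i j B₀) D) (sym ∣B₀∩B₀∣≡5) (sym (∣∁p∩p∣≡0 B₀)))
          (∑-mixedChoices-5set design B₀ ∣B₀∣≡5 i j i+j≡3)

  disjoint? : Decidable (λ B → ∣ B₀ ∩ B ∣ ≡ 0)
  disjoint? B = ∣ B₀ ∩ B ∣ ≟ 0

  two-blocks-disjoint : length (filter disjoint? D) ≡ 2
  two-blocks-disjoint = *-cancelˡ-≡ _ 2 60 (+-cancelʳ-≡ 150 _ _ (begin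
    60 * length (filter disjoint? D) + 150
      ≡⟨ cong₂ (λ n s → 60 * n + s) (sym (length-filter≡∑𝟙 disjoint? D)) (∑-mixedChoices-others 1 2 refl) ⟨
    60 * ∑ d D + ∑ (m 1 2) D
      ≡⟨ cong (_+ ∑ (m 1 2) D) (∑-* 60 d D) ⟨
    ∑[ B ∈ D ] (60 * d B) + ∑ (m 1 2) D
      ≡⟨ ∑-+ _ _ D ⟨
    ∑[ B ∈ D ] (60 * d B + m 1 2 B)
      ≡⟨ ∑-cong (All.zipWith identity (All.tail (meet+miss≡5 design B₀) , others-weight≡0)) ⟨
    ∑[ B ∈ D ] (6 * m 0 3 B + 3 * m 3 0 B)
      ≡⟨ ∑-+ _ _ D ⟩
    ∑[ B ∈ D ] (6 * m 0 3 B) + ∑[ B ∈ D ] (3 * m 3 0 B)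
      ≡⟨ cong₂ _+_ (trans (∑-* 6 (m 0 3) D) (cong (6 *_) (∑-mixedChoices-others 0 3 refl)))
                   (trans (∑-* 3 (m 3 0) D) (cong (3 *_) (+-cancelˡ-≡ 10 _ 10 (∑-mixedChoices-others 3 0 refl)))) ⟩
    6 * 40 + 3 * 10 ∎))
    where
    open ≡-Reasoning
    m : ℕ → ℕ → Subset 11 → ℕ
    m i j = mixedChoices i j B₀
    d : Subset 11 → ℕ
    d B = 𝟙 (disjoint? B)
    identity : ∀ {B} → ∣ B₀ ∩ B ∣ + ∣ ∁ B₀ ∩ B ∣ ≡ 5 × weight ∣ B₀ ∩ B ∣ ≡ 0 →
               6 * m 0 3 B + 3 * m 3 0 B ≡ 60 * d B + m 1 2 B
    identity {B} (i+c≡5 , w≡0) = disjointness-identity ∣ B₀ ∩ B ∣ ∣ ∁ B₀ ∩ B ∣ i+c≡5 w≡0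

  disjoint-pair⇒⊥ : ∀ {x y} → filter disjoint? D ≡ x ∷ y ∷ [] → ⊥
  disjoint-pair⇒⊥ {x} {y} F≡xy
    with ∣B₀∩x∣≡0 ∷ ∣B₀∩y∣≡0 ∷ [] ← subst (All (λ B → ∣ B₀ ∩ B ∣ ≡ 0)) F≡xy (all-filter disjoint? D)
       | ∣x∣≡5 ∷ ∣y∣≡5 ∷ [] ← subst (All (λ B → ∣ B ∣ ≡ 5)) F≡xy (filter⁺ disjoint? (All.tail blockSize))
    = <-irrefl refl (begin
      15 + (1 + 0)      ≤⟨ +-mono-≤ (≤-reflexive (sym w[x∩x]≡15)) (+-monoˡ-≤ 0 w[x∩y]≥1) ⟩
      ∑ w (x ∷ y ∷ [])  ≤⟨ subst (λ F → ∑ w F ≤ ∑ w D) F≡xy (∑-filter-≤ disjoint? w D) ⟩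
      ∑ w D             ≤⟨ m≤n+m (∑ w D) (w B₀) ⟩
      ∑ w (B₀ ∷ D)      ≡⟨ ∑-weight≡15 design x ∣x∣≡5 ⟩
      15                ∎)
    where
    open ≤-Reasoning
    w : Subset 11 → ℕ
    w B = weight ∣ x ∩ B ∣
    w[x∩x]≡15 : w x ≡ 15
    w[x∩x]≡15 = cong weight (trans (cong ∣_∣ (∩-idem x)) ∣x∣≡5)
    w[x∩y]≥1 : 1 ≤ w y
    w[x∩y]≥1 = weight-pos ∣ x ∩ y ∣
      (4≤∣p∩q∣ B₀ x y ∣B₀∣≡5 ∣x∣≡5 ∣y∣≡5 ∣B₀∩x∣≡0 ∣B₀∩y∣≡0)
      (≤-trans (∣p∩q∣≤∣q∣ x y) (≤-reflexive ∣y∣≡5))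

admissible : Admissible 3 11 5 2
admissible 0 _ = divides 33 refl
admissible 1 _ = divides 15 refl
admissible 2 _ = divides 6 refl
admissible 3 _ = divides 2 refl
admissible (suc (suc (suc (suc _)))) (s≤s (s≤s (s≤s ())))

no-3-11-5-2-design : ¬ (∃ λ (D : List (Subset 11)) → IsDesign 3 11 5 2 D)
no-3-11-5-2-design ([] , design)
  with () ← IsDesign.balanced design (inside ∷ inside ∷ inside ∷ ∅) refl
no-3-11-5-2-design (B₀ ∷ D , design) =
  let _ , _ , F≡xy = length≡2 (filter (disjoint? design) D) (two-blocks-disjoint design)
  in disjoint-pair⇒⊥ design F≡xy

theorem3p1 : Admissible 3 11 5 2 × ¬ (∃ λ (D : List (Subset 11)) → IsDesign 3 11 5 2 D)
theorem3p1 = admissible , no-3-11-5-2-design
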